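{- Let $\mathcal T$ be a basic theory and $\zeta\Rightarrow_r\eta$ a graded implication, and suppose there is a forest proof of $\zeta\Rightarrow_r\eta$ from $\mathcal T$. Let $\phi$ be a variable that does not occur negatively in $\zeta$ or in $\eta$, and such that for every implication $\alpha\Rightarrow_d\beta$ in $\mathcal T$, $\phi$ does not occur negatively in $\alpha$ or $\beta$. Then there is a forest proof of $\zeta\Rightarrow_r\eta$ from $\mathcal T$ in which the literal $\neg\phi$ does not occur. Similarly, if $\phi$ does not occur positively in $\zeta$, $\eta$, or in any $\alpha,\beta$ with $\alpha\Rightarrow_d\beta$ in $\mathcal T$, then there is a forest proof of $\zeta\Rightarrow_r\eta$ from $\mathcal T$ in which the literal $\phi$ does not occur.
   Context: Boolean formulas are built from countably many variables and $\bot,\top$ via $\wedge,\vee,\neg$; a variable occurs positively (negatively) in a formula if it has an occurrence within the scope of an even (odd) number of negation signs (for a basic implication this means $\phi$, resp. $\neg\phi$, appears as a literal in it). $\alpha,\beta$ are Boolean equivalent if $\alpha\to\beta$ and $\beta\to\alpha$ are classical tautologies. A graded implication is $\alpha\Rightarrow_d\beta$, $d\in\mathbb R^+=[0,\infty)$. A literal is $\phi$ or $\neg\phi$ for a variable $\phi$; a clause is a finite set of literals, inconsistent if it contains some $\phi$ and $\neg\phi$, consistent otherwise; a clause set is a finite set of clauses. For a clause set $B$, $f(B)=\bigvee_{L\in B}\bigwedge L$ (empty conjunction $=\top$, empty disjunction $=\bot$); $B$ is a clause set for $\alpha$ if $f(B)$ is Boolean equivalent to $\alpha$. A basic implication is $\lambda_1\wedge\dots\wedge\lambda_n\Rightarrow_d\bigvee_{i=1}^l\bigwedge_{j=1}^{k_i}\mu_{ij}$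 with $n\ge1$, $l\ge0$, $k_i\ge1$, where $\{\lambda_1,\dots,\lambda_n\}$ and all $\{\mu_{i1},\dots,\mu_{ik_i}\}$ are consistent clauses; a basic theory is a set of basic implications. A proof forest is a finite directed forest (each component a rooted tree, edges directed from father to child) with a weight in $\mathbb R^+$ on each edge, each node labelled by a clause or by the symbol $\divideontimes$ (nodes identified with labels). A branch is a maximal root-to-leaf path; its length is $0$ if it contains $\divideontimes$ and otherwise the sum of its edge weights; the length of the forest is the maximum length of its branches. A forest proof of $\zeta\Rightarrow_r\eta$ from a basic theory $\mathcal T$ is a proof forest such that: (T1) there is a clause set $B_\zeta$ for $\zeta$ such that each clause of $B_\zeta$ has a root that is a subset of it; (T2) there is a clause set $B_\eta$ for $\eta$ such that every terminal clause includes some clause of $B_\eta$; (T3) the length of the forest is at most $r$; (T4) for every non-terminal clause $L$, all edges from $L$ have the same weight $c$, and one of: (A) $c=0$ and $\mathcal T$ contains a basic implication $\lambda_1\wedge\dots\wedge\lambda_n\Rightarrow_0\bigvee_{i=1}^l\bigwedge_j\mu_{ij}$ with $\{\lambda_1,\dots,\lambda_n\}\subseteq L$ such that for each $i$ some child of $L$ is a clause $L'\subseteq\{\mu_{i1},\dots,\mu_{ik_i}\}\cup L$; (B) $c>0$ and $\mathcal T$ contains a basic implication $\lambda_1\wedge\dots\wedge\lambda_n\Rightarrow_c\bigvee_{i=1}^l\bigwedge_j\mu_{ij}$ with $\{\lambda_1,\dots,\lambda_n\}\subseteq L$ such that for each $i$ some child of $L$ is a clause $L'\subseteq\{\mu_{i1},\dots,\mu_{ik_i}\}$;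 (C) $c=0$, $L$ is inconsistent and $\divideontimes$ is the only child of $L$; (D) $c=0$ and for some variable $\phi$, $L$ has exactly two children, one consisting of $\phi$ together with a subset of $L$, the other of $\neg\phi$ together with a subset of $L$. -}

module Defs where

open import Data.Nat using (ℕ)
open import Data.Bool using (Bool; true; false; not; T; if_then_else_)
  renaming (_∧_ to _and_; _∨_ to _or_)
open import Data.List using (List; []; _∷_; [_]; foldr; _++_)
open import Data.List.Membership.Propositional using (_∈_)
open import Data.List.Relation.Binary.Subset.Propositional using (_⊆_)
open import Data.List.Relation.Unary.All using (All)
open import Data.Product using (Σ; ∃; _×_; _,_; proj₁; proj₂)
open import Data.Sum using (_⊎_)
open import Data.Empty using (⊥)
open import Relation.Nullary using (¬_)
open import Relation.Binary.PropositionalEquality using (_≡_; _≢_)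
open import Relation.Binary.Structures using (IsTotalOrder)

data Form : Set where
  var  : ℕ → Form
  ⊥f   : Form
  ⊤f   : Form
  _∧f_ : Form → Form → Form
  _∨f_ : Form → Form → Form
  ¬f_  : Form → Form

eval : (ℕ → Bool) → Form → Bool
eval ρ (var x)   = ρ x
eval ρ ⊥f        = false
eval ρ ⊤f        = true
eval ρ (a ∧f b)  = eval ρ a and eval ρ b
eval ρ (a ∨f b)  = eval ρ a or eval ρ b
eval ρ (¬f a)    = not (eval ρ a)

Tautology→ : Form → Form → Set
Tautology→ α β = (ρ : ℕ → Bool) → T (eval ρ α) → T (eval ρ β)

BoolEquiv : Form → Form → Set
BoolEquiv α β = Tautology→ α β × Tautology→ β α

-- Occ φ b α : φ has an occurrence in α within the scope of an even
-- (b = true) resp. odd (b = false) number of negation signs.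
data Occ (φ : ℕ) : Bool → Form → Set where
  occ-var : Occ φ true (var φ)
  occ-¬   : ∀ {b α} → Occ φ (not b) α → Occ φ b (¬f α)
  occ-∧ˡ  : ∀ {b α β} → Occ φ b α → Occ φ b (α ∧f β)
  occ-∧ʳ  : ∀ {b α β} → Occ φ b β → Occ φ b (α ∧f β)
  occ-∨ˡ  : ∀ {b α β} → Occ φ b α → Occ φ b (α ∨f β)
  occ-∨ʳ  : ∀ {b α β} → Occ φ b β → Occ φ b (α ∨f β)

OccursPositively : ℕ → Form → Set
OccursPositively φ α = Occ φ true α

OccursNegatively : ℕ → Form → Set
OccursNegatively φ α = Occ φ false α

-- Literals, clauses, clause sets (finite sets represented by lists,
-- read up to membership)

data Lit : Set where
  pos : ℕ → Lit
  neg : ℕ → Lit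

Clause : Set
Clause = List Lit

ClauseSet : Set
ClauseSet = List Clause

Inconsistent : Clause → Set
Inconsistent L = ∃ λ φ → pos φ ∈ L × neg φ ∈ L

Consistent : Clause → Set
Consistent L = ¬ Inconsistent L

litF : Lit → Form
litF (pos φ) = var φ
litF (neg φ) = ¬f var φ

conjF : Clause → Form
conjF = foldr (λ l f → litF l ∧f f) ⊤f

fB : ClauseSet → Form
fB = foldr (λ L f → conjF L ∨f f) ⊥f

ClauseSetFor : ClauseSet → Form → Set
ClauseSetFor B α = BoolEquiv (fB B) α

record Weights : Set₁ where
  field
    Carrier      : Set
    0#           : Carrier
    _+_          : Carrier → Carrier → Carrier
    _≤_          : Carrier → Carrier → Set
    +-assoc      : ∀ x y z → (x + y) + z ≡ x + (y + z)
    +-comm       : ∀ x y → x + y ≡ y + x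
    +-identityˡ  : ∀ x → 0# + x ≡ x
    ≤-isTotalOrder : IsTotalOrder _≡_ _≤_
    0≤           : ∀ x → 0# ≤ x
    +-mono-≤     : ∀ {x y u v} → x ≤ y → u ≤ v → (x + u) ≤ (y + v)

module WithWeights (W : Weights) where
  open Weights W

  _>0 : Carrier → Set
  c >0 = (0# ≤ c) × (c ≢ 0#)

  -- basic implication λ₁∧…∧λₙ ⇒_d ⋁ᵢ ⋀ⱼ μᵢⱼ
  record BasicImp : Set where
    field
      lhs            : Clause
      lhs-nonempty   : lhs ≢ []
      lhs-consistent : Consistent lhs
      weight         : Carrier
      rhs            : List Clause
      rhs-nonempty   : All (λ M → M ≢ []) rhs
      rhs-consistent : All Consistent rhs
  open BasicImp public

  antecedent : BasicImp → Form
  antecedent b = conjF (lhs b)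

  consequent : BasicImp → Form
  consequent b = fB (rhs b)

  -- a basic theory: a (possibly infinite) set of basic implications
  BasicTheory : Set₁
  BasicTheory = BasicImp → Set

  data Label : Set where
    clause : Clause → Label
    star   : Label

  isStar : Label → Bool
  isStar (clause _) = false
  isStar star       = true

  data PTree : Set where
    node : Label → List (Carrier × PTree) → PTree

  Forest : Set
  Forest = List PTree

  root : PTree → Label
  root (node l _) = l

  data Sub : PTree → PTree → Set where
    here  : ∀ {t} → Sub t t
    there : ∀ {s l cs w u} → (w , u) ∈ cs → Sub s u → Sub s (node l cs)

  NodeOf : Forest → PTree → Set
  NodeOf F s = ∃ λ t → t ∈ F × Sub s t

  -- Branch t s x : a maximal path from the root of t to a leaf, where
  -- s says whether it contains ⋇ and x is the sum of its edge weights
  data Branch : PTree → Bool → Carrier → Set where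
    leaf : ∀ {l} → Branch (node l []) (isStar l) 0#
    step : ∀ {l cs w u s x} → (w , u) ∈ cs → Branch u s x →
           Branch (node l cs) (isStar l or s) (w + x)

  branchLength : Bool → Carrier → Carrier
  branchLength s x = if s then 0# else x

  LengthAtMost : Forest → Carrier → Set
  LengthAtMost F r = ∀ {t s x} → t ∈ F → Branch t s x → branchLength s x ≤ r

  SomeChildClause : List (Carrier × PTree) → (Clause → Set) → Set
  SomeChildClause cs P =
    ∃ λ e → e ∈ cs × ∃ λ L' → root (proj₂ e) ≡ clause L' × P L'

  RuleA : BasicTheory → Clause → Carrier → List (Carrier × PTree) → Set
  RuleA 𝒯 L c cs = c ≡ 0# × ∃ λ b → 𝒯 b × weight b ≡ 0# × lhs b ⊆ L ×
    All (λ M → SomeChildClause cs (λ L' → L' ⊆ M ++ L)) (rhs b)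

  RuleB : BasicTheory → Clause → Carrier → List (Carrier × PTree) → Set
  RuleB 𝒯 L c cs = c >0 × ∃ λ b → 𝒯 b × weight b ≡ c × lhs b ⊆ L ×
    All (λ M → SomeChildClause cs (λ L' → L' ⊆ M)) (rhs b)

  RuleC : Clause → Carrier → List (Carrier × PTree) → Set
  RuleC L c cs = c ≡ 0# × Inconsistent L ×
    ∃ λ t → cs ≡ [ (c , t) ] × root t ≡ star

  SplitChild : Lit → Clause → PTree → Set
  SplitChild ℓ L t = ∃ λ L' → root t ≡ clause L' × ℓ ∈ L' × L' ⊆ ℓ ∷ L

  RuleD : Clause → Carrier → List (Carrier × PTree) → Set
  RuleD L c cs = c ≡ 0# × ∃ λ φ → ∃ λ t₁ → ∃ λ t₂ →
    cs ≡ (c , t₁) ∷ (c , t₂) ∷ [] ×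
    ((SplitChild (pos φ) L t₁ × SplitChild (neg φ) L t₂) ⊎
     (SplitChild (neg φ) L t₁ × SplitChild (pos φ) L t₂))

  T1 : Forest → Form → Set
  T1 F ζ = ∃ λ Bζ → ClauseSetFor Bζ ζ ×
    (∀ {C} → C ∈ Bζ → ∃ λ t → t ∈ F × ∃ λ L → root t ≡ clause L × L ⊆ C)

  T2 : Forest → Form → Set
  T2 F η = ∃ λ Bη → ClauseSetFor Bη η ×
    (∀ {L} → NodeOf F (node (clause L) []) → ∃ λ C → C ∈ Bη × C ⊆ L)

  T3 : Forest → Carrier → Set
  T3 F r = LengthAtMost F r

  T4 : BasicTheory → Forest → Set
  T4 𝒯 F = ∀ {L cs} → NodeOf F (node (clause L) cs) → cs ≢ [] →
    ∃ λ c → All (λ e → proj₁ e ≡ c) cs ×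
      (RuleA 𝒯 L c cs ⊎ RuleB 𝒯 L c cs ⊎ RuleC L c cs ⊎ RuleD L c cs)

  ForestProof : BasicTheory → Form → Carrier → Form → Forest → Set
  ForestProof 𝒯 ζ r η F = T1 F ζ × T2 F η × T3 F r × T4 𝒯 F

  LitOccurs : Lit → Forest → Set
  LitOccurs ℓ F = ∃ λ L → ∃ λ cs → NodeOf F (node (clause L) cs) × ℓ ∈ L

-- Fix φ and a polarity σ: `good` is φ with polarity σ, `bad` its complement, and
-- φ has no occurrence of polarity `not σ` in ζ, η or 𝒯.  Each tree of a forest
-- proof is translated by induction (`translate`): a clause L becomes
-- strip L ++ Γ (`strip` deletes `bad`, Γ is a bad-free context from above);
-- rules (A)/(B) survive since 𝒯 never mentions `bad`; a split (D) on φ is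
-- dropped, its `bad` child replacing the node, and wherever that child used
-- `bad` the translated `good` child is grafted instead (an `Oracle`).  At the
-- roots there is no `good` child: the oracle splits on all variables of the
-- clause set for ζ until one of its clauses is forced (`Roots`).  Clause sets
-- for ζ and η are cleaned (clashing clauses dropped, `bad` stripped), which by
-- the monotonicity lemma `polarity-mono` keeps their meaning (`clean-for`).

module Submission where

open import Defs
open import Data.Bool using (Bool; true; false; not; T)
  renaming (_∧_ to _and_; _∨_ to _or_)
open import Data.Bool.Properties using (not-involutive; T-∧; T-∨)
open import Data.Empty using (⊥; ⊥-elim)
open import Data.List using (List; []; _∷_; [_]; _++_; map; filter; concat)
open import Data.List.Membership.Propositional using (_∈_; _∉_; find; lose)
open import Data.List.Membership.Propositional.Properties
  using (∈-++⁺ˡ; ∈-++⁺ʳ; ∈-++⁻; ∈-filter⁺; ∈-filter⁻; ∈-map⁺; ∈-map⁻; ∈-concat⁺′)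
open import Data.List.Relation.Binary.Subset.Propositional using (_⊆_)
open import Data.List.Relation.Binary.Subset.Propositional.Properties
  using (⊆-refl; ⊆-trans; xs⊆xs++ys; xs⊆ys++xs; ++⁺ʳ; ⊆∷∧∉⇒⊆; filter-⊆)
open import Data.List.Relation.Unary.All using (All; []; _∷_; lookup)
  renaming (map to mapAll)
open import Data.List.Relation.Unary.Any using (Any; here; there; any?)
open import Data.Nat using (ℕ; _≟_)
open import Data.Product using (Σ; ∃; ∃₂; _×_; _,_; proj₁; proj₂)
  renaming (map to map×)
open import Data.Sum using (_⊎_; inj₁; inj₂; [_,_]′) renaming (map to map⊎)
open import Data.Unit using (tt)
open import Function using (_∘_)
open import Function.Bundles using (Equivalence)
open import Relation.Binary.Definitions using (DecidableEquality)
open import Relation.Binary.PropositionalEquality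
  using (_≡_; _≢_; refl; sym; trans; cong; subst)
open import Relation.Nullary using (¬_; Dec; yes; no; does)
open import Relation.Nullary.Decidable using (_×-dec_; _⊎-dec_; ¬?; map′)

∧-mono : ∀ {a a′ b b′} → (T a → T a′) → (T b → T b′) → T (a and b) → T (a′ and b′)
∧-mono {a} {a′} {b} {b′} f g =
  Equivalence.from (T-∧ {a′} {b′}) ∘ map× f g ∘ Equivalence.to (T-∧ {a} {b})

∨-mono : ∀ {a a′ b b′} → (T a → T a′) → (T b → T b′) → T (a or b) → T (a′ or b′)
∨-mono {a} {a′} {b} {b′} f g =
  Equivalence.from (T-∨ {a′} {b′}) ∘ map⊎ f g ∘ Equivalence.to (T-∨ {a} {b})

not-antitone : ∀ {a b} → (T b → T a) → T (not a) → T (not b)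
not-antitone {_}    {false} _ _  = tt
not-antitone {false} {true} f _  = f tt
not-antitone {true} {true}  _ ()

T-contradiction : ∀ {a} → T a → T (not a) → ⊥
T-contradiction {true} _ ()

++-⊆ : ∀ {A B K : Clause} → A ⊆ K → B ⊆ K → A ++ B ⊆ K
++-⊆ {A} A⊆K B⊆K = [ A⊆K , B⊆K ]′ ∘ ∈-++⁻ A

litVar : Lit → ℕ
litVar (pos x) = x
litVar (neg x) = x

lit : Bool → ℕ → Lit
lit true  = pos
lit false = neg

litVar-lit : ∀ s x → litVar (lit s x) ≡ x
litVar-lit true  x = refl
litVar-lit false x = refl

_≟ˡ_ : DecidableEquality Lit
pos x ≟ˡ pos y = map′ (cong pos) (cong litVar) (x ≟ y)
neg x ≟ˡ neg y = map′ (cong neg) (cong litVar) (x ≟ y)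
pos x ≟ˡ neg y = no λ ()
neg x ≟ˡ pos y = no λ ()

open import Data.List.Membership.DecPropositional _≟ˡ_ using (_∈?_)

conj-true⁻ : ∀ ρ L → T (eval ρ (conjF L)) → ∀ {l} → l ∈ L → T (eval ρ (litF l))
conj-true⁻ ρ (l ∷ L) t (here refl) = proj₁ (Equivalence.to (T-∧ {eval ρ (litF l)}) t)
conj-true⁻ ρ (l ∷ L) t (there m) =
  conj-true⁻ ρ L (proj₂ (Equivalence.to (T-∧ {eval ρ (litF l)}) t)) m

conj-true⁺ : ∀ ρ L → (∀ {l} → l ∈ L → T (eval ρ (litF l))) → T (eval ρ (conjF L))
conj-true⁺ ρ []      h = tt
conj-true⁺ ρ (l ∷ L) h =
  Equivalence.from (T-∧ {eval ρ (litF l)}) (h (here refl) , conj-true⁺ ρ L (h ∘ there))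

disj-true⁻ : ∀ ρ B → T (eval ρ (fB B)) → ∃ λ C → C ∈ B × T (eval ρ (conjF C))
disj-true⁻ ρ (C ∷ B) t with Equivalence.to (T-∨ {eval ρ (conjF C)}) t
... | inj₁ tC = C , here refl , tC
... | inj₂ tB with disj-true⁻ ρ B tB
...   | D , D∈B , tD = D , there D∈B , tD

disj-true⁺ : ∀ ρ B {C} → C ∈ B → T (eval ρ (conjF C)) → T (eval ρ (fB B))
disj-true⁺ ρ (C ∷ B) (here refl) t = Equivalence.from (T-∨ {eval ρ (conjF C)}) (inj₁ t)
disj-true⁺ ρ (C ∷ B) (there m)   t =
  Equivalence.from (T-∨ {eval ρ (conjF C)}) (inj₂ (disj-true⁺ ρ B m t))

-- A clause read as a partial valuation: `Assigned v K` says K decides v, and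
-- `valuation K` makes exactly the positive literals of K true.
Assigned : ℕ → Clause → Set
Assigned v K = pos v ∈ K ⊎ neg v ∈ K

assigned? : ∀ v K → Dec (Assigned v K)
assigned? v K = (pos v ∈? K) ⊎-dec (neg v ∈? K)

valuation : Clause → ℕ → Bool
valuation K x = does (pos x ∈? K)

valuation-sat : ∀ {K l} → Consistent K → l ∈ K → T (eval (valuation K) (litF l))
valuation-sat {K} {pos x} _ l∈K with pos x ∈? K
... | yes _  = tt
... | no x∉K = x∉K l∈K
valuation-sat {K} {neg x} consistent l∈K with pos x ∈? K
... | yes x∈K = consistent (x , x∈K , l∈K)
... | no _    = tt

valuation-complete : ∀ {K l} → Assigned (litVar l) K →
                     T (eval (valuation K) (litF l)) → l ∈ K
valuation-complete {K} {pos x} _ t with pos x ∈? K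
... | yes l∈K = l∈K
... | no _    = ⊥-elim t
valuation-complete {K} {neg x} (inj₂ l∈K) _ = l∈K
valuation-complete {K} {neg x} (inj₁ x∈K) t with pos x ∈? K
... | yes _   = ⊥-elim t
... | no x∉K  = ⊥-elim (x∉K x∈K)

consistent-∷ : ∀ {K} ℓ → ¬ Assigned (litVar ℓ) K → Consistent K → Consistent (ℓ ∷ K)
consistent-∷ ℓ unassigned consistent (x , here refl , here ())
consistent-∷ ℓ unassigned consistent (x , here refl , there n∈K) = unassigned (inj₂ n∈K)
consistent-∷ ℓ unassigned consistent (x , there p∈K , here refl) = unassigned (inj₁ p∈K)
consistent-∷ ℓ unassigned consistent (x , there p∈K , there n∈K) = consistent (x , p∈K , n∈K)

assigned-self : ∀ ℓ {K} → Assigned (litVar ℓ) (ℓ ∷ K)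
assigned-self (pos x) = inj₁ (here refl)
assigned-self (neg x) = inj₂ (here refl)

inconsistent? : ∀ K → Dec (Inconsistent K)
inconsistent? K = map′ fromAny toAny (any? complemented? K)
  where
  Complemented : Lit → Set
  Complemented l = ∃ λ x → l ≡ pos x × neg x ∈ K

  complemented? : ∀ l → Dec (Complemented l)
  complemented? (pos x) = map′ (λ n → x , refl , n) (λ { (_ , refl , n) → n }) (neg x ∈? K)
  complemented? (neg x) = no λ { (_ , () , _) }

  fromAny : Any Complemented K → Inconsistent K
  fromAny a with find a
  ... | _ , p∈K , x , refl , n∈K = x , p∈K , n∈K

  toAny : Inconsistent K → Any Complemented K
  toAny (x , p∈K , n∈K) = lose p∈K (x , refl , n∈K)

vars : ClauseSet → List ℕ
vars B = map litVar (concat B)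

var∈vars : ∀ {B C l} → C ∈ B → l ∈ C → litVar l ∈ vars B
var∈vars C∈B l∈C = ∈-map⁺ litVar (∈-concat⁺′ l∈C C∈B)

module Polarity (φ : ℕ) (σ : Bool) where

  good bad : Lit
  good = lit σ φ
  bad  = lit (not σ) φ

  good≢bad : good ≢ bad
  good≢bad = distinct σ
    where
    distinct : ∀ s → lit s φ ≢ lit (not s) φ
    distinct true  ()
    distinct false ()

  ≢bad : ∀ {l} → litVar l ≢ φ → l ≢ bad
  ≢bad l≢φ l≡bad = l≢φ (trans (cong litVar l≡bad) (litVar-lit (not σ) φ))

  over-φ : ∀ l → litVar l ≡ φ → l ≡ good ⊎ l ≡ bad
  over-φ l = sort σ l
    where
    sort : ∀ s l → litVar l ≡ φ → l ≡ lit s φ ⊎ l ≡ lit (not s) φ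
    sort true  (pos _) refl = inj₁ refl
    sort true  (neg _) refl = inj₂ refl
    sort false (pos _) refl = inj₂ refl
    sort false (neg _) refl = inj₁ refl

  bad-occ : ∀ {L} → bad ∈ L → Occ φ (not σ) (conjF L)
  bad-occ (here refl) = occ-∧ˡ (lit-occ (not σ))
    where
    lit-occ : ∀ s → Occ φ s (litF (lit s φ))
    lit-occ true  = occ-var
    lit-occ false = occ-¬ occ-var
  bad-occ (there m) = occ-∧ʳ (bad-occ m)

  bad-occ-fB : ∀ {B C} → C ∈ B → bad ∈ C → Occ φ (not σ) (fB B)
  bad-occ-fB (here refl) bad∈C = occ-∨ˡ (bad-occ bad∈C)
  bad-occ-fB (there m)   bad∈C = occ-∨ʳ (bad-occ-fB m bad∈C)

  Clash : Clause → Set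
  Clash C = good ∈ C × bad ∈ C

  clash? : ∀ C → Dec (Clash C)
  clash? C = (good ∈? C) ×-dec (bad ∈? C)

  inconsistent-at-φ : ∀ {C} → pos φ ∈ C → neg φ ∈ C → Clash C
  inconsistent-at-φ = sort σ
    where
    sort : ∀ s {C} → pos φ ∈ C → neg φ ∈ C → lit s φ ∈ C × lit (not s) φ ∈ C
    sort true  p n = p , n
    sort false p n = n , p

  orient : ∀ {A : Set} {P : Lit → A → Set} {a₁ a₂ : A} →
    (P (pos φ) a₁ × P (neg φ) a₂) ⊎ (P (neg φ) a₁ × P (pos φ) a₂) →
    ∃₂ λ ag ab → ag ∈ a₁ ∷ a₂ ∷ [] × ab ∈ a₁ ∷ a₂ ∷ [] × P good ag × P bad ab
  orient {A} {P} {a₁} {a₂} = sort σ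
    where
    sort : ∀ s → (P (pos φ) a₁ × P (neg φ) a₂) ⊎ (P (neg φ) a₁ × P (pos φ) a₂) →
           ∃₂ λ ag ab → ag ∈ a₁ ∷ a₂ ∷ [] × ab ∈ a₁ ∷ a₂ ∷ [] ×
                        P (lit s φ) ag × P (lit (not s) φ) ab
    sort true  (inj₁ (p₁ , n₂)) = a₁ , a₂ , here refl , there (here refl) , p₁ , n₂
    sort true  (inj₂ (n₁ , p₂)) = a₂ , a₁ , there (here refl) , here refl , p₂ , n₁
    sort false (inj₁ (p₁ , n₂)) = a₂ , a₁ , there (here refl) , here refl , n₂ , p₁
    sort false (inj₂ (n₁ , p₂)) = a₁ , a₂ , here refl , there (here refl) , n₁ , p₂

  good-assigned : ∀ {K} → good ∈ K → Assigned φ K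
  good-assigned = sort σ
    where
    sort : ∀ s {K} → lit s φ ∈ K → Assigned φ K
    sort true  = inj₁
    sort false = inj₂

  not-both : ∀ ρ → T (eval ρ (litF good)) → T (eval ρ (litF bad)) → ⊥
  not-both ρ = sort σ
    where
    sort : ∀ s → T (eval ρ (litF (lit s φ))) → T (eval ρ (litF (lit (not s) φ))) → ⊥
    sort true  g b = T-contradiction g b
    sort false g b = T-contradiction b g

  _[φ≔_] : (ℕ → Bool) → Bool → ℕ → Bool
  (ρ [φ≔ v ]) x with x ≟ φ
  ... | yes _ = v
  ... | no _  = ρ x

  update-φ : ∀ ρ v → (ρ [φ≔ v ]) φ ≡ v
  update-φ ρ v with φ ≟ φ
  ... | yes _   = refl
  ... | no φ≢φ  = ⊥-elim (φ≢φ refl)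

  update-lit : ∀ ρ v {l} → litVar l ≢ φ → eval (ρ [φ≔ v ]) (litF l) ≡ eval ρ (litF l)
  update-lit ρ v {pos x} x≢φ = other x≢φ
    where
    other : ∀ {x} → x ≢ φ → (ρ [φ≔ v ]) x ≡ ρ x
    other {x} x≢φ with x ≟ φ
    ... | yes x≡φ = ⊥-elim (x≢φ x≡φ)
    ... | no _    = refl
  update-lit ρ v {neg x} x≢φ = cong not (update-lit ρ v {pos x} x≢φ)

  bad-updated : ∀ ρ → T (eval (ρ [φ≔ not σ ]) (litF bad))
  bad-updated ρ = sort σ
    where
    sort : ∀ s → T (eval (ρ [φ≔ not s ]) (litF (lit (not s) φ)))
    sort true  = subst (T ∘ not) (sym (update-φ ρ false)) tt
    sort false = subst T (sym (update-φ ρ true)) tt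

  -- Monotonicity in φ: making `lit (not s) φ` true cannot make a formula true
  -- unless φ occurs in it with polarity `not s`, and cannot make it false unless
  -- φ occurs in it with polarity s.  (Both halves are needed for ¬.)
  polarity-mono : ∀ s α ρ →
    (¬ Occ φ (not s) α → T (eval (ρ [φ≔ not s ]) α) → T (eval ρ α)) ×
    (¬ Occ φ s α → T (eval ρ α) → T (eval (ρ [φ≔ not s ]) α))
  polarity-mono s (var x) ρ with x ≟ φ
  polarity-mono true  (var x) ρ | yes refl = (λ _ ()) , (λ no-occ _ → ⊥-elim (no-occ occ-var))
  polarity-mono false (var x) ρ | yes refl = (λ no-occ _ → ⊥-elim (no-occ occ-var)) , (λ _ _ → tt)
  polarity-mono s     (var x) ρ | no _     = (λ _ t → t) , (λ _ t → t)
  polarity-mono s ⊥f ρ = (λ _ t → t) , (λ _ t → t)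
  polarity-mono s ⊤f ρ = (λ _ t → t) , (λ _ t → t)
  polarity-mono s (α ∧f β) ρ =
    (λ h → ∧-mono (proj₁ IHα (h ∘ occ-∧ˡ)) (proj₁ IHβ (h ∘ occ-∧ʳ))) ,
    (λ h → ∧-mono (proj₂ IHα (h ∘ occ-∧ˡ)) (proj₂ IHβ (h ∘ occ-∧ʳ)))
    where
    IHα = polarity-mono s α ρ
    IHβ = polarity-mono s β ρ
  polarity-mono s (α ∨f β) ρ =
    (λ h → ∨-mono (proj₁ IHα (h ∘ occ-∨ˡ)) (proj₁ IHβ (h ∘ occ-∨ʳ))) ,
    (λ h → ∨-mono (proj₂ IHα (h ∘ occ-∨ˡ)) (proj₂ IHβ (h ∘ occ-∨ʳ)))
    where
    IHα = polarity-mono s α ρ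
    IHβ = polarity-mono s β ρ
  polarity-mono s (¬f α) ρ =
    (λ h → not-antitone (proj₂ IH (h ∘ occ-¬ ∘ subst (λ b → Occ φ b α) (sym (not-involutive s))))) ,
    (λ h → not-antitone (proj₁ IH (h ∘ occ-¬)))
    where
    IH = polarity-mono s α ρ

  strip : Clause → Clause
  strip = filter (λ l → ¬? (l ≟ˡ bad))

  strip⁺ : ∀ {L l} → l ∈ L → l ≢ bad → l ∈ strip L
  strip⁺ = ∈-filter⁺ (λ l → ¬? (l ≟ˡ bad))

  strip⁻ : ∀ {L l} → l ∈ strip L → l ∈ L × l ≢ bad
  strip⁻ = ∈-filter⁻ (λ l → ¬? (l ≟ˡ bad))

  strip-⊆ : ∀ {L} → strip L ⊆ L
  strip-⊆ {L} = filter-⊆ (λ l → ¬? (l ≟ˡ bad)) L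

  bad∉strip : ∀ {L} → bad ∉ strip L
  bad∉strip {L} bad∈ = proj₂ (strip⁻ {L} bad∈) refl

  strip-into : ∀ M {L L'} → L' ⊆ M ++ L → strip L' ⊆ M ++ strip L
  strip-into M L'⊆ l∈ with strip⁻ l∈
  ... | l∈L' , l≢bad = [ ∈-++⁺ˡ , (λ l∈L → ∈-++⁺ʳ M (strip⁺ l∈L l≢bad)) ]′ (∈-++⁻ M (L'⊆ l∈L'))

  clean : ClauseSet → ClauseSet
  clean B = map strip (filter (¬? ∘ clash?) B)

  clean⁺ : ∀ {B C} → C ∈ B → ¬ Clash C → strip C ∈ clean B
  clean⁺ C∈B no-clash = ∈-map⁺ strip (∈-filter⁺ (¬? ∘ clash?) C∈B no-clash)

  clean⁻ : ∀ {B D} → D ∈ clean B → ∃ λ C → C ∈ B × ¬ Clash C × D ≡ strip C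
  clean⁻ D∈ with ∈-map⁻ strip D∈
  ... | C , C∈ , refl with ∈-filter⁻ (¬? ∘ clash?) C∈
  ...   | C∈B , no-clash = C , C∈B , no-clash , refl

  -- Cleaning preserves what a clause set means for a formula α in which φ has
  -- no occurrence of polarity `not σ`: a clause C containing `bad` may be
  -- weakened to strip C because α, true once φ is set so that `bad` holds,
  -- stays true whatever φ is.
  clean-for : ∀ {B α} → ClauseSetFor B α → ¬ Occ φ (not σ) α → ClauseSetFor (clean B) α
  clean-for {B} {α} (B⇒α , α⇒B) α-free = cleaned⇒α , α⇒cleaned
    where
    cleaned⇒α : Tautology→ (fB (clean B)) α
    cleaned⇒α ρ t with disj-true⁻ ρ (clean B) t
    ... | _ , D∈ , D-true with clean⁻ D∈
    ...   | C , C∈B , no-clash , refl with bad ∈? C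
    ...     | no bad∉C =
      B⇒α ρ (disj-true⁺ ρ B C∈B (conj-true⁺ ρ C λ l∈C →
        conj-true⁻ ρ (strip C) D-true (strip⁺ l∈C λ { refl → bad∉C l∈C })))
    ...     | yes bad∈C =
      proj₁ (polarity-mono σ α ρ) α-free
        (B⇒α ρ′ (disj-true⁺ ρ′ B C∈B (conj-true⁺ ρ′ C true-in-ρ′)))
      where
      ρ′ = ρ [φ≔ not σ ]
      not-over-φ : ∀ {l} → l ∈ C → l ≢ bad → litVar l ≢ φ
      not-over-φ {l} l∈C l≢bad l-over-φ with over-φ l l-over-φ
      ... | inj₁ refl = no-clash (l∈C , bad∈C)
      ... | inj₂ refl = l≢bad refl
      true-in-ρ′ : ∀ {l} → l ∈ C → T (eval ρ′ (litF l))
      true-in-ρ′ {l} l∈C with l ≟ˡ bad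
      ... | yes refl  = bad-updated ρ
      ... | no l≢bad  =
        subst T (sym (update-lit ρ (not σ) {l} (not-over-φ l∈C l≢bad)))
          (conj-true⁻ ρ (strip C) D-true (strip⁺ {C} l∈C l≢bad))
    α⇒cleaned : Tautology→ α (fB (clean B))
    α⇒cleaned ρ t with disj-true⁻ ρ B (α⇒B ρ t)
    ... | C , C∈B , C-true =
      disj-true⁺ ρ (clean B) (clean⁺ C∈B no-clash)
        (conj-true⁺ ρ (strip C) (conj-true⁻ ρ C C-true ∘ strip-⊆))
      where
      no-clash : ¬ Clash C
      no-clash (good∈ , bad∈) = not-both ρ (conj-true⁻ ρ C C-true good∈) (conj-true⁻ ρ C C-true bad∈)

module Translation (W : Weights) (𝒯 : WithWeights.BasicTheory W) (φ : ℕ) (σ : Bool)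
  (r : Weights.Carrier W) (Bη : ClauseSet)
  (𝒯-free : ∀ b → 𝒯 b → ¬ Occ φ (not σ) (WithWeights.antecedent W b) ×
                         ¬ Occ φ (not σ) (WithWeights.consequent W b))
  where
  open Weights W
  open WithWeights W
  open Polarity φ σ

  +-identityʳ : ∀ p → p + 0# ≡ p
  +-identityʳ p = trans (+-comm p 0#) (+-identityˡ p)

  Rule : Clause → Carrier → List (Carrier × PTree) → Set
  Rule L c cs = RuleA 𝒯 L c cs ⊎ RuleB 𝒯 L c cs ⊎ RuleC L c cs ⊎ RuleD L c cs

  Uniform : Carrier → List (Carrier × PTree) → Set
  Uniform c cs = All (λ e → proj₁ e ≡ c) cs

  starLeaf : PTree
  starLeaf = node star []

  -- Valid p t: t is a tree of the new forest hung at height p: no clause of it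
  -- contains `bad`, every inner node obeys (T4), every terminal clause contains
  -- a clause of clean Bη (T2), and terminal clauses lie at height at most r (T3).
  data Valid : Carrier → PTree → Set where
    terminal : ∀ {p L} → (∃ λ C → C ∈ clean Bη × C ⊆ L) → p ≤ r → bad ∉ L →
               Valid p (node (clause L) [])
    closed   : ∀ {p} → Valid p starLeaf
    inner    : ∀ {p L cs c} → cs ≢ [] → Uniform c cs → Rule L c cs → bad ∉ L →
               All (λ e → Valid (p + c) (proj₂ e)) cs → Valid p (node (clause L) cs)

  -- Sound p u: the subtree u of the given forest proof, hung at height p, obeys
  -- (T4) at its nodes, (T2) at its terminal clauses and (T3) on its branches.
  Sound : Carrier → PTree → Set
  Sound p u =
    (∀ {L cs} → Sub (node (clause L) cs) u → cs ≢ [] → ∃ λ c → Uniform c cs × Rule L c cs) ×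
    (∀ {L} → Sub (node (clause L) []) u → ∃ λ C → C ∈ Bη × C ⊆ L) ×
    (∀ {x} → Branch u false x → (p + x) ≤ r)

  sound-child : ∀ {p L cs w u} → Sound p (node (clause L) cs) → (w , u) ∈ cs → Sound (p + w) u
  sound-child {p} {w = w} (rules , terminals , bounded) m =
    rules ∘ there m , terminals ∘ there m ,
    λ {x} br → subst (_≤ r) (sym (+-assoc p w x)) (bounded (step m br))

  Rooted : Carrier → Clause → Set
  Rooted p K = Σ PTree λ t → Valid p t × ∃ λ R → root t ≡ clause R × R ⊆ K × K ⊆ R

  justified : ∀ {p K c ks} → ks ≢ [] → Uniform c ks → Rule K c ks → bad ∉ K →
              All (λ e → Valid (p + c) (proj₂ e)) ks → Rooted p K
  justified {K = K} {ks = ks} ks≢[] uniform rule bad∉K valid =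
    node (clause K) ks , inner ks≢[] uniform rule bad∉K valid , K , refl , ⊆-refl , ⊆-refl

  -- Oracle Γ p: every bad-free extension K of Γ by `good` is the root of a valid
  -- tree at height p.  It is what replaces the use of `bad` inside a subproof.
  Oracle : Clause → Carrier → Set
  Oracle Γ p = ∀ K → Γ ⊆ K → good ∈ K → bad ∉ K → Rooted p K

  oracle-weaken : ∀ {Γ Γ′ p} → Γ ⊆ Γ′ → Oracle Γ p → Oracle Γ′ p
  oracle-weaken Γ⊆Γ′ oracle K Γ′⊆K = oracle K (⊆-trans Γ⊆Γ′ Γ′⊆K)

  Translatable : PTree → Set
  Translatable u = ∀ {L} → root u ≡ clause L → ∀ Γ → bad ∉ Γ → ∀ p → Sound p u →
                   (bad ∈ L → Oracle Γ p) → Rooted p (strip L ++ Γ)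

  bad∉strip++ : ∀ {L Γ} → bad ∉ Γ → bad ∉ strip L ++ Γ
  bad∉strip++ {L} bad∉Γ bad∈ = [ bad∉strip {L} , bad∉Γ ]′ (∈-++⁻ (strip L) bad∈)

  absorb : ∀ M {L L′ K} → L′ ⊆ M ++ L → strip L ⊆ K → strip L′ ++ K ⊆ M ++ K
  absorb M {K = K} L′⊆ strip⊆K = ++-⊆ (⊆-trans (strip-into M L′⊆) (++⁺ʳ M strip⊆K)) (xs⊆ys++xs K M)

  -- A translated child for each disjunct M of a rule, collected into a uniform
  -- list of children; a closed ⋇-leaf is appended so the node stays inner even
  -- when the rule has no disjuncts.
  children-for : ∀ {c q cs} {P Q : Clause → Clause → Set} (Ms : List Clause) →
    (∀ {M} → M ∈ Ms → SomeChildClause cs (P M) →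
       Σ PTree λ t → Valid q t × ∃ λ R → root t ≡ clause R × Q M R) →
    All (λ M → SomeChildClause cs (P M)) Ms →
    Σ (List (Carrier × PTree)) λ ks → ks ≢ [] × All (λ M → SomeChildClause ks (Q M)) Ms ×
      Uniform c ks × All (λ e → Valid q (proj₂ e)) ks
  children-for {c} [] _ [] = (c , starLeaf) ∷ [] , (λ ()) , [] , refl ∷ [] , closed ∷ []
  children-for {c} {P = P} {Q} (M ∷ Ms) translate (child ∷ children)
    with translate (here refl) child | children-for {c} {P = P} {Q} Ms (translate ∘ there) children
  ... | t , valid , R , root-t , QR | ks , _ , found , uniform , valids =
    (c , t) ∷ ks , (λ ()) ,
    ((c , t) , here refl , R , root-t , QR) ∷ mapAll (λ (e , e∈ , rest) → e , there e∈ , rest) found ,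
    refl ∷ uniform , valid ∷ valids

  -- Translation of a terminal clause L: if it clashes on φ the oracle supplies the
  -- tree, otherwise its clause of Bη survives cleaning inside strip L.
  translate-leaf : ∀ L Γ → bad ∉ Γ → ∀ p → Sound p (node (clause L) []) →
                   (bad ∈ L → Oracle Γ p) → Rooted p (strip L ++ Γ)
  translate-leaf L Γ bad∉Γ p sound oracle with clash? L
  ... | yes (good∈L , bad∈L) =
    oracle bad∈L (strip L ++ Γ) (xs⊆ys++xs Γ (strip L))
      (∈-++⁺ˡ (strip⁺ {L} good∈L good≢bad)) (bad∉strip++ {L} bad∉Γ)
  ... | no no-clash with proj₁ (proj₂ sound) here
  ...   | C , C∈Bη , C⊆L =
    node (clause (strip L ++ Γ)) [] ,
    terminal (strip C , clean⁺ C∈Bη (no-clash ∘ map× C⊆L C⊆L) ,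
              ⊆-trans (strip-into [] C⊆L) (xs⊆xs++ys (strip L) Γ))
             (subst (_≤ r) (+-identityʳ p) (proj₂ (proj₂ sound) leaf))
             (bad∉strip++ {L} bad∉Γ) ,
    strip L ++ Γ , refl , ⊆-refl , ⊆-refl

  module Node (L : Clause) (cs : List (Carrier × PTree))
    (translate-child : ∀ {e} → e ∈ cs → Translatable (proj₂ e))
    (Γ : Clause) (bad∉Γ : bad ∉ Γ) (p : Carrier) (sound : Sound p (node (clause L) cs))
    (oracle : bad ∈ L → Oracle Γ p) (c : Carrier) (uniform : Uniform c cs) where

    R₀ : Clause
    R₀ = strip L ++ Γ

    bad∉R₀ : bad ∉ R₀
    bad∉R₀ = bad∉strip++ {L} bad∉Γ

    strip⊆R₀ : strip L ⊆ R₀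
    strip⊆R₀ = xs⊆xs++ys (strip L) Γ

    keep : ∀ {l} → l ∈ L → l ≢ bad → l ∈ R₀
    keep l∈L l≢bad = ∈-++⁺ˡ (strip⁺ {L} l∈L l≢bad)

    child-sound : ∀ {w u} → (w , u) ∈ cs → Sound (p + c) u
    child-sound {u = u} m = subst (λ w → Sound (p + w) u) (lookup uniform m) (sound-child sound m)

    height₀ : c ≡ 0# → p + c ≡ p
    height₀ c≡0 = trans (cong (p +_) c≡0) (+-identityʳ p)

    -- A child L′ ⊆ M ++ L of a weightless rule, with M bad-free, can only use
    -- `bad` from L, where the oracle of the node applies.
    oracle-below : c ≡ 0# → ∀ {M L′} → L′ ⊆ M ++ L → bad ∉ M → bad ∈ L′ → Oracle R₀ (p + c)
    oracle-below c≡0 {M} L′⊆ bad∉M bad∈L′ with ∈-++⁻ M (L′⊆ bad∈L′)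
    ... | inj₁ bad∈M = ⊥-elim (bad∉M bad∈M)
    ... | inj₂ bad∈L =
      subst (Oracle R₀) (sym (height₀ c≡0)) (oracle-weaken (xs⊆ys++xs Γ (strip L)) (oracle bad∈L))

    lhs-kept : ∀ {b} → 𝒯 b → lhs b ⊆ L → lhs b ⊆ R₀
    lhs-kept {b} b∈𝒯 lhs⊆L l∈ = keep (lhs⊆L l∈) λ { refl → proj₁ (𝒯-free b b∈𝒯) (bad-occ l∈) }

    rhs-free : ∀ {b M} → 𝒯 b → M ∈ rhs b → bad ∉ M
    rhs-free {b} b∈𝒯 M∈ bad∈M = proj₂ (𝒯-free b b∈𝒯) (bad-occ-fB M∈ bad∈M)

    childA : ∀ {b} → 𝒯 b → c ≡ 0# → ∀ {M} → M ∈ rhs b →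
      SomeChildClause cs (λ L′ → L′ ⊆ M ++ L) →
      Σ PTree λ t → Valid (p + c) t × ∃ λ R → root t ≡ clause R × R ⊆ M ++ R₀
    childA b∈𝒯 c≡0 {M} M∈ (_ , e∈ , L′ , root≡ , L′⊆)
      with translate-child e∈ root≡ R₀ bad∉R₀ (p + c) (child-sound e∈)
             (oracle-below c≡0 L′⊆ (rhs-free b∈𝒯 M∈))
    ... | t , valid , R , root-t , R⊆ , _ = t , valid , R , root-t , ⊆-trans R⊆ (absorb M L′⊆ strip⊆R₀)

    caseA : c ≡ 0# → (∃ λ b → 𝒯 b × weight b ≡ 0# × lhs b ⊆ L ×
              All (λ M → SomeChildClause cs (λ L′ → L′ ⊆ M ++ L)) (rhs b)) → Rooted p R₀
    caseA c≡0 (b , b∈𝒯 , w≡0 , lhs⊆L , children)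
      with children-for {c} (rhs b) (childA b∈𝒯 c≡0) children
    ... | ks , ks≢[] , found , uniform′ , valid =
      justified ks≢[] uniform′ (inj₁ (c≡0 , b , b∈𝒯 , w≡0 , lhs-kept b∈𝒯 lhs⊆L , found)) bad∉R₀ valid

    -- (B): a child L′ ⊆ M is bad-free and is translated in the empty context.
    childB : ∀ {b} → 𝒯 b → ∀ {M} → M ∈ rhs b → SomeChildClause cs (λ L′ → L′ ⊆ M) →
      Σ PTree λ t → Valid (p + c) t × ∃ λ R → root t ≡ clause R × R ⊆ M
    childB b∈𝒯 {M} M∈ (_ , e∈ , L′ , root≡ , L′⊆M)
      with translate-child e∈ root≡ [] (λ ()) (p + c) (child-sound e∈)
             (⊥-elim ∘ rhs-free b∈𝒯 M∈ ∘ L′⊆M)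
    ... | t , valid , R , root-t , R⊆ , _ =
      t , valid , R , root-t , ⊆-trans R⊆ (++-⊆ (⊆-trans (strip-⊆ {L′}) L′⊆M) λ ())

    caseB : c >0 → (∃ λ b → 𝒯 b × weight b ≡ c × lhs b ⊆ L ×
              All (λ M → SomeChildClause cs (λ L′ → L′ ⊆ M)) (rhs b)) → Rooted p R₀
    caseB c>0 (b , b∈𝒯 , w≡c , lhs⊆L , children)
      with children-for {c} (rhs b) (childB b∈𝒯) children
    ... | ks , ks≢[] , found , uniform′ , valid =
      justified ks≢[] uniform′ (inj₂ (inj₁ (c>0 , b , b∈𝒯 , w≡c , lhs-kept b∈𝒯 lhs⊆L , found))) bad∉R₀ valid

    -- (C): an inconsistency at φ is a use of `bad`, answered by the oracle;
    -- any other inconsistency survives in R₀.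
    caseC : c ≡ 0# → Inconsistent L → Rooted p R₀
    caseC c≡0 (ψ , pos∈L , neg∈L) with ψ ≟ φ
    ... | yes refl with inconsistent-at-φ pos∈L neg∈L
    ...   | good∈L , bad∈L = oracle bad∈L R₀ (xs⊆ys++xs Γ (strip L)) (keep good∈L good≢bad) bad∉R₀
    caseC c≡0 (ψ , pos∈L , neg∈L) | no ψ≢φ =
      justified (λ ()) (refl ∷ [])
        (inj₂ (inj₂ (inj₁ (c≡0 , (ψ , keep pos∈L (≢bad ψ≢φ) , keep neg∈L (≢bad ψ≢φ)) ,
                           starLeaf , refl , refl))))
        bad∉R₀ (closed ∷ [])

    split-child∈ : ∀ {t₁ t₂ t} → cs ≡ (c , t₁) ∷ (c , t₂) ∷ [] → t ∈ t₁ ∷ t₂ ∷ [] → (c , t) ∈ cs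
    split-child∈ cs≡ t∈ = subst (_ ∈_) (sym cs≡) (∈-map⁺ (c ,_) t∈)

    Sides : ℕ → Clause → PTree → PTree → Set
    Sides ψ K t₁ t₂ = (SplitChild (pos ψ) K t₁ × SplitChild (neg ψ) K t₂) ⊎
                      (SplitChild (neg ψ) K t₁ × SplitChild (pos ψ) K t₂)

    split-other : c ≡ 0# → ∀ {ℓ t} → ℓ ≢ bad → (c , t) ∈ cs → SplitChild ℓ L t →
      Σ PTree λ t′ → Valid (p + c) t′ × SplitChild ℓ R₀ t′
    split-other c≡0 {ℓ} ℓ≢bad e∈ (L₁ , root≡ , ℓ∈L₁ , L₁⊆)
      with translate-child e∈ root≡ R₀ bad∉R₀ (p + c) (child-sound e∈)
             (oracle-below c≡0 {M = [ ℓ ]} L₁⊆ λ { (here refl) → ℓ≢bad refl })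
    ... | t′ , valid , R , root-t′ , R⊆ , ⊆R =
      t′ , valid , R , root-t′ , ⊆R (∈-++⁺ˡ (strip⁺ {L₁} ℓ∈L₁ ℓ≢bad)) ,
      ⊆-trans R⊆ (absorb [ ℓ ] L₁⊆ strip⊆R₀)

    split-node : c ≡ 0# → ∀ {ψ} (t₁ t₂ : PTree) → Valid (p + c) t₁ → Valid (p + c) t₂ →
                 Sides ψ R₀ t₁ t₂ → Rooted p R₀
    split-node c≡0 {ψ} t₁ t₂ valid₁ valid₂ sides =
      justified (λ ()) (refl ∷ refl ∷ []) (inj₂ (inj₂ (inj₂ (c≡0 , ψ , t₁ , t₂ , refl , sides))))
        bad∉R₀ (valid₁ ∷ valid₂ ∷ [])

    caseD-other : c ≡ 0# → ∀ {ψ t₁ t₂} → ψ ≢ φ → cs ≡ (c , t₁) ∷ (c , t₂) ∷ [] →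
                  Sides ψ L t₁ t₂ → Rooted p R₀
    caseD-other c≡0 ψ≢φ cs≡ (inj₁ (side₁ , side₂)) =
      let t₁′ , valid₁ , side₁′ = split-other c≡0 (≢bad ψ≢φ) (split-child∈ cs≡ (here refl)) side₁
          t₂′ , valid₂ , side₂′ = split-other c≡0 (≢bad ψ≢φ) (split-child∈ cs≡ (there (here refl))) side₂
      in split-node c≡0 t₁′ t₂′ valid₁ valid₂ (inj₁ (side₁′ , side₂′))
    caseD-other c≡0 ψ≢φ cs≡ (inj₂ (side₁ , side₂)) =
      let t₁′ , valid₁ , side₁′ = split-other c≡0 (≢bad ψ≢φ) (split-child∈ cs≡ (here refl)) side₁
          t₂′ , valid₂ , side₂′ = split-other c≡0 (≢bad ψ≢φ) (split-child∈ cs≡ (there (here refl))) side₂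
      in split-node c≡0 t₁′ t₂′ valid₁ valid₂ (inj₂ (side₁′ , side₂′))

    -- (D) on φ: the `good` child, translated in any context K ⊇ R₀ containing
    -- `good`, is an oracle for R₀.
    good-oracle : c ≡ 0# → ∀ {tg Lg} → (c , tg) ∈ cs → root tg ≡ clause Lg →
                  Lg ⊆ good ∷ L → Oracle R₀ (p + c)
    good-oracle c≡0 {Lg = Lg} tg∈ root≡ Lg⊆ K R₀⊆K good∈K bad∉K
      with translate-child tg∈ root≡ K bad∉K (p + c) (child-sound tg∈)
             (oracle-weaken R₀⊆K ∘ oracle-below c≡0 {M = [ good ]} Lg⊆ λ { (here e) → good≢bad (sym e) })
    ... | t , valid , R , root-t , R⊆ , ⊆R =
      t , valid , R , root-t ,
      ⊆-trans (⊆-trans R⊆ (absorb [ good ] Lg⊆ (⊆-trans strip⊆R₀ R₀⊆K)))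
              (λ { (here refl) → good∈K ; (there x∈K) → x∈K }) ,
      ⊆R ∘ xs⊆ys++xs K (strip Lg)

    -- (D) on φ: the split disappears; the `bad` child, translated in context R₀
    -- with the oracle from the `good` child, replaces the node.
    caseD-φ : c ≡ 0# → ∀ {t₁ t₂} → cs ≡ (c , t₁) ∷ (c , t₂) ∷ [] → Sides φ L t₁ t₂ → Rooted p R₀
    caseD-φ c≡0 cs≡ sides with orient {P = λ ℓ t → SplitChild ℓ L t} sides
    ... | tg , tb , tg∈ , tb∈ , (Lg , root-g , _ , Lg⊆) , (Lb , root-b , _ , Lb⊆)
      with translate-child (split-child∈ cs≡ tb∈) root-b R₀ bad∉R₀ (p + c)
             (child-sound (split-child∈ cs≡ tb∈)) (λ _ → good-oracle c≡0 (split-child∈ cs≡ tg∈) root-g Lg⊆)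
    ... | t , valid , R , root-t , R⊆ , ⊆R =
      t , subst (λ q → Valid q t) (height₀ c≡0) valid , R , root-t ,
      ⊆∷∧∉⇒⊆ (⊆-trans R⊆ (absorb [ bad ] Lb⊆ strip⊆R₀)) (bad∉strip++ {Lb} bad∉R₀ ∘ R⊆) ,
      ⊆R ∘ xs⊆ys++xs R₀ (strip Lb)

    caseD : c ≡ 0# → (∃ λ ψ → ∃ λ t₁ → ∃ λ t₂ → cs ≡ (c , t₁) ∷ (c , t₂) ∷ [] × Sides ψ L t₁ t₂) →
            Rooted p R₀
    caseD c≡0 (ψ , t₁ , t₂ , cs≡ , sides) with ψ ≟ φ
    ... | yes refl = caseD-φ c≡0 cs≡ sides
    ... | no ψ≢φ   = caseD-other c≡0 ψ≢φ cs≡ sides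

  translate-node : ∀ L cs → (∀ {e} → e ∈ cs → Translatable (proj₂ e)) → ∀ Γ → bad ∉ Γ → ∀ p →
    Sound p (node (clause L) cs) → (bad ∈ L → Oracle Γ p) → Rooted p (strip L ++ Γ)
  translate-node L [] _ = translate-leaf L
  translate-node L cs@(_ ∷ _) translate-child Γ bad∉Γ p sound oracle
    with proj₁ sound here (λ ())
  ... | c , uniform , rule = by-rule rule
    where
    open Node L cs translate-child Γ bad∉Γ p sound oracle c uniform
    by-rule : Rule L c cs → Rooted p R₀
    by-rule (inj₁ (c≡0 , A))               = caseA c≡0 A
    by-rule (inj₂ (inj₁ (c>0 , B)))        = caseB c>0 B
    by-rule (inj₂ (inj₂ (inj₁ (c≡0 , inconsistent , _)))) = caseC c≡0 inconsistent
    by-rule (inj₂ (inj₂ (inj₂ (c≡0 , D)))) = caseD c≡0 D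

  translate : ∀ u → Translatable u
  translate-children : ∀ cs {e} → e ∈ cs → Translatable (proj₂ e)
  translate (node (clause L) cs) refl = translate-node L cs (translate-children cs)
  translate (node star _) ()
  translate-children ((_ , u) ∷ _)  (here refl) = translate u
  translate-children (_ ∷ cs)       (there e∈)  = translate-children cs e∈

  valid-sub : ∀ {p t s} → Valid p t → Sub s t → ∃ λ q → Valid q s
  valid-sub valid here = _ , valid
  valid-sub (inner _ _ _ _ valids) (there e∈ sub) = valid-sub (lookup valids e∈) sub

  valid-rule : ∀ {q L cs} → Valid q (node (clause L) cs) → cs ≢ [] →
               ∃ λ c → Uniform c cs × Rule L c cs
  valid-rule (terminal _ _ _) []≢[] = ⊥-elim ([]≢[] refl)
  valid-rule (inner _ uniform rule _ _) _ = _ , uniform , rule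

  valid-terminal : ∀ {q L} → Valid q (node (clause L) []) → ∃ λ C → C ∈ clean Bη × C ⊆ L
  valid-terminal (terminal found _ _) = found
  valid-terminal (inner []≢[] _ _ _ _) = ⊥-elim ([]≢[] refl)

  valid-bad-free : ∀ {q L cs} → Valid q (node (clause L) cs) → bad ∉ L
  valid-bad-free (terminal _ _ bad∉L)   = bad∉L
  valid-bad-free (inner _ _ _ bad∉L _) = bad∉L

  valid-branch : ∀ {p t s x} → Valid p t → Branch t s x → branchLength s (p + x) ≤ r
  valid-branch {p} (terminal _ p≤r _) leaf = subst (_≤ r) (sym (+-identityʳ p)) p≤r
  valid-branch closed leaf = 0≤ r
  valid-branch (inner []≢[] _ _ _ _) leaf = ⊥-elim ([]≢[] refl)
  valid-branch {p} {s = s} (inner {c = c} _ uniform _ _ valids) (step {w = w} {x = x} e∈ br) =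
    subst (λ y → branchLength s y ≤ r) height (valid-branch (lookup valids e∈) br)
    where
    height : (p + c) + x ≡ p + (w + x)
    height = trans (+-assoc p c x) (cong (λ z → p + (z + x)) (sym (lookup uniform e∈)))

  -- A
  -- root L ⊆ C may use `bad`; its oracle splits any K ⊇ strip C on all variables
  -- of Bζ, and at each complete K the clause of Bζ forced by K yields the tree.
  module Roots (Bζ : ClauseSet) (ζ : Form) (Bζ-for : ClauseSetFor Bζ ζ)
    (ζ-free : ¬ Occ φ (not σ) ζ) (F : Forest)
    (rooted : ∀ {C} → C ∈ Bζ → ∃ λ t → t ∈ F × ∃ λ L → root t ≡ clause L × L ⊆ C)
    (F-sound : ∀ {t} → t ∈ F → Sound 0# t) where

    -- K contains a cleaned clause of Bζ, so its valuation satisfies ζ.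
    Extends : Clause → Set
    Extends K = ∃ λ C → C ∈ Bζ × ¬ Clash C × strip C ⊆ K

    extends-∷ : ∀ {K} ℓ → Extends K → Extends (ℓ ∷ K)
    extends-∷ ℓ (C , C∈Bζ , no-clash , strip⊆K) = C , C∈Bζ , no-clash , there ∘ strip⊆K

    forces-Bζ : ∀ {K} → Consistent K → Extends K → T (eval (valuation K) (fB Bζ))
    forces-Bζ {K} consistent (C , C∈Bζ , no-clash , strip⊆K) =
      proj₂ Bζ-for ρ (proj₁ (clean-for {Bζ} Bζ-for ζ-free) ρ
        (disj-true⁺ ρ (clean Bζ) (clean⁺ {Bζ} C∈Bζ no-clash)
          (conj-true⁺ ρ (strip C) (valuation-sat consistent ∘ strip⊆K))))
      where
      ρ = valuation K

    forced : ∀ {K D} → (∀ v → v ∈ vars Bζ → Assigned v K) → D ∈ Bζ →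
             T (eval (valuation K) (conjF D)) → D ⊆ K
    forced {K} {D} assigned D∈Bζ D-true l∈D =
      valuation-complete (assigned _ (var∈vars D∈Bζ l∈D)) (conj-true⁻ (valuation K) D D-true l∈D)

    -- At a complete K, the translation of the root tree of the forced clause D,
    -- in context K, is rooted at K (D ⊆ K, so its root is bad-free).
    complete : ∀ K → Consistent K → bad ∉ K → Extends K →
               (∀ v → v ∈ vars Bζ → Assigned v K) → Rooted 0# K
    complete K consistent bad∉K extends assigned
      with disj-true⁻ (valuation K) Bζ (forces-Bζ consistent extends)
    ... | D , D∈Bζ , D-true with rooted D∈Bζ
    ...   | t , t∈F , LD , root≡ , LD⊆D
      with translate t root≡ K bad∉K 0# (F-sound t∈F)
             (λ bad∈LD → ⊥-elim (bad∉K (forced assigned D∈Bζ D-true (LD⊆D bad∈LD))))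
    ...     | t′ , valid , R , root-t′ , R⊆ , ⊆R =
      t′ , valid , R , root-t′ ,
      ⊆-trans R⊆ (++-⊆ (forced assigned D∈Bζ D-true ∘ LD⊆D ∘ strip-⊆ {LD}) ⊆-refl) ,
      ⊆R ∘ xs⊆ys++xs K (strip LD)

    -- Split K on the variables V, keeping every variable of Bζ in V or assigned
    -- by K; as `good ∈ K`, no split is on φ.
    split-all : ∀ V K → Consistent K → good ∈ K → bad ∉ K → Extends K →
                (∀ v → v ∈ vars Bζ → v ∈ V ⊎ Assigned v K) → Rooted 0# K
    split-all [] K consistent _ bad∉K extends covered =
      complete K consistent bad∉K extends (λ v v∈ → [ (λ ()) , (λ a → a) ]′ (covered v v∈))
    split-all (ψ ∷ V) K consistent good∈K bad∉K extends covered with assigned? ψ K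
    ... | yes ψ-assigned = split-all V K consistent good∈K bad∉K extends covered′
      where
      covered′ : ∀ v → v ∈ vars Bζ → v ∈ V ⊎ Assigned v K
      covered′ v v∈ with covered v v∈
      ... | inj₁ (here refl)  = inj₂ ψ-assigned
      ... | inj₁ (there v∈V)  = inj₁ v∈V
      ... | inj₂ v-assigned   = inj₂ v-assigned
    ... | no ψ-unassigned =
      let t₊ , valid₊ , side₊ = branch (pos ψ) refl
          t₋ , valid₋ , side₋ = branch (neg ψ) refl
      in justified (λ ()) (refl ∷ refl ∷ [])
           (inj₂ (inj₂ (inj₂ (refl , ψ , t₊ , t₋ , refl , inj₁ (side₊ , side₋)))))
           bad∉K (valid₊ ∷ valid₋ ∷ [])
      where
      ψ≢φ : ψ ≢ φ
      ψ≢φ refl = ψ-unassigned (good-assigned good∈K)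

      covered′ : ∀ ℓ → litVar ℓ ≡ ψ → ∀ v → v ∈ vars Bζ → v ∈ V ⊎ Assigned v (ℓ ∷ K)
      covered′ ℓ ℓ-over-ψ v v∈ with covered v v∈
      ... | inj₁ (here refl) = inj₂ (subst (λ w → Assigned w (ℓ ∷ K)) ℓ-over-ψ (assigned-self ℓ))
      ... | inj₁ (there v∈V) = inj₁ v∈V
      ... | inj₂ v-assigned  = inj₂ (map⊎ there there v-assigned)

      branch : ∀ ℓ → litVar ℓ ≡ ψ → Σ PTree λ t → Valid (0# + 0#) t × SplitChild ℓ K t
      branch ℓ ℓ-over-ψ =
        let t , valid , R , root-t , R⊆ , ⊆R =
              split-all V (ℓ ∷ K)
                (consistent-∷ ℓ (subst (λ w → ¬ Assigned w K) (sym ℓ-over-ψ) ψ-unassigned) consistent)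
                (there good∈K)
                (λ { (here ℓ≡bad) → ≢bad (ψ≢φ ∘ trans (sym ℓ-over-ψ)) (sym ℓ≡bad)
                   ; (there bad∈K) → bad∉K bad∈K })
                (extends-∷ ℓ extends)
                (covered′ ℓ ℓ-over-ψ)
        in t , subst (λ q → Valid q t) (sym (+-identityˡ 0#)) valid , R , root-t , ⊆R (here refl) , R⊆

    root-oracle : ∀ {C} → C ∈ Bζ → ¬ Clash C → Oracle (strip C) 0#
    root-oracle C∈Bζ no-clash K strip⊆K good∈K bad∉K with inconsistent? K
    ... | yes inconsistent =
      justified (λ ()) (refl ∷ []) (inj₂ (inj₂ (inj₁ (refl , inconsistent , starLeaf , refl , refl))))
        bad∉K (closed ∷ [])
    ... | no consistent =
      split-all (vars Bζ) K consistent good∈K bad∉K (_ , C∈Bζ , no-clash , strip⊆K) (λ v v∈ → inj₁ v∈)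

    root-tree : ∀ {C} → C ∈ Bζ → ¬ Clash C →
                Σ PTree λ t → Valid 0# t × ∃ λ R → root t ≡ clause R × R ⊆ strip C
    root-tree {C} C∈Bζ no-clash with rooted C∈Bζ
    ... | t , t∈F , L , root≡ , L⊆C
      with translate t root≡ (strip C) (bad∉strip {C}) 0# (F-sound t∈F) (λ _ → root-oracle C∈Bζ no-clash)
    ...   | t′ , valid , R , root-t′ , R⊆ , _ =
      t′ , valid , R , root-t′ , ⊆-trans R⊆ (++-⊆ (strip-into [] L⊆C) ⊆-refl)

    forest-for : ∀ B → (∀ {C} → C ∈ B → C ∈ Bζ) →
      Σ Forest λ F′ → All (Valid 0#) F′ ×
        (∀ {C} → C ∈ B → ¬ Clash C → ∃ λ t → t ∈ F′ × ∃ λ R → root t ≡ clause R × R ⊆ strip C)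
    forest-for [] _ = [] , [] , λ ()
    forest-for (C ∷ B) B⊆Bζ with forest-for B (B⊆Bζ ∘ there) | clash? C
    ... | F′ , valid , found | yes clash =
      F′ , valid , λ { (here refl) no-clash → ⊥-elim (no-clash clash) ; (there C∈B) → found C∈B }
    ... | F′ , valid , found | no no-clash =
      let t , valid-t , rest = root-tree (B⊆Bζ (here refl)) no-clash
      in t ∷ F′ , valid-t ∷ valid ,
         λ { (here refl) _ → t , here refl , rest
           ; (there C∈B) no-clash′ → let t′ , t′∈ , rest′ = found C∈B no-clash′ in t′ , there t′∈ , rest′ }

bad-free-proof : (W : Weights) → let open WithWeights W in
  (𝒯 : BasicTheory) (ζ η : Form) (r : Weights.Carrier W) →
  (∃ λ F → ForestProof 𝒯 ζ r η F) → (φ : ℕ) (σ : Bool) →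
  ¬ Occ φ (not σ) ζ → ¬ Occ φ (not σ) η →
  (∀ b → 𝒯 b → ¬ Occ φ (not σ) (antecedent b) × ¬ Occ φ (not σ) (consequent b)) →
  ∃ λ F′ → ForestProof 𝒯 ζ r η F′ × ¬ LitOccurs (Polarity.bad φ σ) F′
bad-free-proof W 𝒯 ζ η r
  (F , (Bζ , Bζ-for , rooted) , (Bη , Bη-for , terminals) , bounded , rules) φ σ ζ-free η-free 𝒯-free =
  F′ , (T1′ , T2′ , T3′ , T4′) , bad-free
  where
  open Weights W
  open WithWeights W
  open Polarity φ σ
  open Translation W 𝒯 φ σ r Bη 𝒯-free

  F-sound : ∀ {t} → t ∈ F → Sound 0# t
  F-sound t∈F =
    (λ sub → rules (_ , t∈F , sub)) , (λ sub → terminals (_ , t∈F , sub)) ,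
    λ {x} br → subst (_≤ r) (sym (+-identityˡ x)) (bounded t∈F br)

  open Roots Bζ ζ Bζ-for ζ-free F rooted F-sound

  new = forest-for Bζ (λ C∈ → C∈)

  F′ : Forest
  F′ = proj₁ new

  node-valid : ∀ {s} → NodeOf F′ s → ∃ λ q → Valid q s
  node-valid (t , t∈ , sub) = valid-sub (lookup (proj₁ (proj₂ new)) t∈) sub

  roots : ∀ {D} → D ∈ clean Bζ → ∃ λ t → t ∈ F′ × ∃ λ L → root t ≡ clause L × L ⊆ D
  roots D∈ with clean⁻ D∈
  ... | C , C∈Bζ , no-clash , refl = proj₂ (proj₂ new) C∈Bζ no-clash

  T1′ : T1 F′ ζ
  T1′ = clean Bζ , clean-for {Bζ} Bζ-for ζ-free , roots

  T2′ : T2 F′ η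
  T2′ = clean Bη , clean-for {Bη} Bη-for η-free , valid-terminal ∘ proj₂ ∘ node-valid

  T3′ : T3 F′ r
  T3′ {s = s} {x} t∈ br =
    subst (λ y → branchLength s y ≤ r) (+-identityˡ x) (valid-branch (lookup (proj₁ (proj₂ new)) t∈) br)

  T4′ : T4 𝒯 F′
  T4′ node∈ cs≢[] = valid-rule (proj₂ (node-valid node∈)) cs≢[]

  bad-free : ¬ LitOccurs bad F′
  bad-free (_ , _ , node∈ , bad∈L) = valid-bad-free (proj₂ (node-valid node∈)) bad∈L

lemma5p5 : (W : Weights) → let open WithWeights W in
    (𝒯 : BasicTheory) (ζ η : Form) (r : Weights.Carrier W) →
    (∃ λ F → ForestProof 𝒯 ζ r η F) →
    (φ : ℕ) →
    ((¬ OccursNegatively φ ζ × ¬ OccursNegatively φ η ×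
      (∀ b → 𝒯 b → ¬ OccursNegatively φ (antecedent b) × ¬ OccursNegatively φ (consequent b))) →
     ∃ λ F' → ForestProof 𝒯 ζ r η F' × ¬ LitOccurs (neg φ) F')
    ×
    ((¬ OccursPositively φ ζ × ¬ OccursPositively φ η ×
      (∀ b → 𝒯 b → ¬ OccursPositively φ (antecedent b) × ¬ OccursPositively φ (consequent b))) →
     ∃ λ F' → ForestProof 𝒯 ζ r η F' × ¬ LitOccurs (pos φ) F')
lemma5p5 W 𝒯 ζ η r proof φ =
  (λ (ζ-free , η-free , 𝒯-free) → bad-free-proof W 𝒯 ζ η r proof φ true  ζ-free η-free 𝒯-free) ,
  (λ (ζ-free , η-free , 𝒯-free) → bad-free-proof W 𝒯 ζ η r proof φ false ζ-free η-free 𝒯-free)
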